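{- Let $G$ be a finite directed multigraph without loops and oriented 2-cycles which is block-decomposable. Suppose $G$ contains distinct nodes $o,x,y,p$ such that the only edges of $G$ incident to $o$ are the single edges $o\to x$, $y\to o$ and $p\to o$, that $G$ contains the edge $x\to y$, and that $p$ is joined by an edge neither to $x$ nor to $y$. Then in every block decomposition of $G$, the three edges $o\to x$, $x\to y$, $y\to o$ are the three edges of a single triangle block, and the edge $p\to o$ is a spike block.
   Context: Blocks are the following directed graphs; every node of a block is colored white (an "outlet") or black (a "dead end"). Spike: a single edge $u\to v$, with $u,v$ both white. Triangle: an oriented 3-cycle $u\to v\to w\to u$, with all three nodes white. Fork: a white node $c$ and two black nodes $p,q$, with either the two edges $c\to p$, $c\to q$ or the two edges $p\to c$, $q\to c$. Diamond: white nodes $u,v$ and black nodes $p,q$, with edges $u\to v$ (the mid-edge), $v\to p$, $p\to u$, $v\to q$, $q\to u$ (boundary edges). Square: a white central node $o$ and black corner nodes $a,b,c,d$, with edges $o\to a$, $a\to b$, $b\to o$, $o\to c$, $c\to b$, $c\to d$, $d\to o$, $a\to d$. A block decomposition of a directed graph $G$ is a way of obtaining $G$ from a finite disjoint union of blocks by repeatedly identifying two white nodes belonging to different blocks, each white node being identified at most once and black nodes never identified; the identified node becomes black. If two edges then join the same two nodes, they form a double edge if they have the same direction and are both removed (annihilate) if they have opposite directions. $G$ is block-decomposable if it admits a block decomposition. -}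

module Defs where

open import Data.Nat using (ℕ; zero; suc; _+_; _≤_)
open import Data.Fin using (Fin; #_; _≟_)
open import Data.Product using (Σ; ∃; ∃-syntax; _×_; _,_; proj₁; proj₂)
open import Data.Sum using (_⊎_)
open import Data.List using (List; []; _∷_; map; concatMap; filter; length; allFin)
open import Relation.Binary.PropositionalEquality using (_≡_; _≢_)
open import Relation.Nullary.Decidable using (_×-dec_)

data Color : Set where
  white black : Color          -- white = outlet, black = dead end

data BlockType : Set where
  spike triangle fork-out fork-in diamond square : BlockType

size : BlockType → ℕ
size spike    = 2
size triangle = 3
size fork-out = 3
size fork-in  = 3
size diamond  = 4
size square   = 5

color : (T : BlockType) → Fin (size T) → Color
-- spike: u = 0, v = 1
color spike _ = white
-- triangle: u = 0, v = 1, w = 2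
color triangle _ = white
-- fork: c = 0, p = 1, q = 2
color fork-out Fin.zero = white
color fork-out _ = black
color fork-in Fin.zero = white
color fork-in _ = black
-- diamond: u = 0, v = 1, p = 2, q = 3
color diamond Fin.zero = white
color diamond (Fin.suc Fin.zero) = white
color diamond _ = black
-- square: o = 0, a = 1, b = 2, c = 3, d = 4
color square Fin.zero = white
color square _ = black

edges : (T : BlockType) → List (Fin (size T) × Fin (size T))
edges spike    = (# 0 , # 1) ∷ []
edges triangle = (# 0 , # 1) ∷ (# 1 , # 2) ∷ (# 2 , # 0) ∷ []
edges fork-out = (# 0 , # 1) ∷ (# 0 , # 2) ∷ []
edges fork-in  = (# 1 , # 0) ∷ (# 2 , # 0) ∷ []
edges diamond  = (# 0 , # 1) ∷ (# 1 , # 2) ∷ (# 2 , # 0) ∷ (# 1 , # 3) ∷ (# 3 , # 0) ∷ []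
edges square   = (# 0 , # 1) ∷ (# 1 , # 2) ∷ (# 2 , # 0) ∷ (# 0 , # 3)
               ∷ (# 3 , # 2) ∷ (# 3 , # 4) ∷ (# 4 , # 0) ∷ (# 1 , # 4) ∷ []

-- Finite directed multigraphs on the node set Fin n, given by edge
-- multiplicities  mult i j = number of edges i → j.

Multigraph : ℕ → Set
Multigraph n = Fin n → Fin n → ℕ

NoLoops : ∀ {n} → Multigraph n → Set
NoLoops {n} G = (i : Fin n) → G i i ≡ 0

NoTwoCycles : ∀ {n} → Multigraph n → Set
NoTwoCycles {n} G = (i j : Fin n) → G i j ≡ 0 ⊎ G j i ≡ 0

-- The map φ sends each node of the disjoint union to the node of G it
-- becomes after all identifications (the result is identified with G
-- via φ, i.e. up to isomorphism).

record BlockDecomposition {n : ℕ} (G : Multigraph n) : Set where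
  field
    k    : ℕ
    type : Fin k → BlockType

  Node : Set
  Node = Σ (Fin k) (λ b → Fin (size (type b)))

  nodeColor : Node → Color
  nodeColor (b , u) = color (type b) u

  field
    φ : Node → Fin n
    surj : (i : Fin n) → ∃[ a ] φ a ≡ i
    glue : (a a' : Node) → φ a ≡ φ a' →
           a ≡ a' ⊎ (proj₁ a ≢ proj₁ a' × nodeColor a ≡ white × nodeColor a' ≡ white)
    -- each white node is identified at most once
    atMostTwo : (a a' a'' : Node) → φ a ≡ φ a' → φ a ≡ φ a'' →
                a ≡ a' ⊎ a ≡ a'' ⊎ a' ≡ a''

  blockEdges : Fin k → List (Fin n × Fin n)
  blockEdges b = map (λ e → φ (b , proj₁ e) , φ (b , proj₂ e)) (edges (type b))

  allEdges : List (Fin n × Fin n)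
  allEdges = concatMap blockEdges (allFin k)

  count : Fin n → Fin n → ℕ
  count i j = length (filter (λ e → (proj₁ e ≟ i) ×-dec (proj₂ e ≟ j)) allEdges)

  field
    -- parallel edges of the same direction add up (multiple edges),
    -- opposite edges annihilate pairwise: the net number of edges
    -- i → j equals that of G.
    edgesMatch : (i j : Fin n) → count i j + G j i ≡ count j i + G i j

BlockDecomposable : ∀ {n} → Multigraph n → Set
BlockDecomposable G = BlockDecomposition G

-- A lift of an edge i → j of G is a block edge mapped onto it by φ. Every lift over an
-- edge absent from G is cancelled by a lift of the reverse edge, and a block edge at a
-- black node is never cancelled (its endpoint has no other preimage). Since o only meets
-- o → x, y → o and p → o, black neighbours of a preimage of o map to x, y or p, which
-- forbids a preimage of o with two in-neighbours (those are black twins, and twins over y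
-- and p would turn the lift of x → y into an uncancelled x → p). So the lifts of y → o
-- and p → o end at the two glued preimages of o, each lying in a spike or a triangle. The
-- lift of o → x leaves one of them; two spikes cannot carry it, and in the other wrong
-- configurations some edge x → p, y → p or a second o → x appears that nothing cancels.
module Submission where

open import Defs
open import Function using (_∘_)
open import Data.Nat using (ℕ; zero; suc; _+_; _≤_; _<_; z≤n; s≤s)
open import Data.Nat.Properties
  using (+-comm; ≤-trans; ≤-reflexive; <-≤-trans; <-irrefl; m≤m+n; m≤n⇒m≤o+n; +-monoʳ-≤; +-mono-≤)
open import Data.Fin using (Fin; _≟_)
open import Data.Fin.Properties using (all?; any?)
open import Data.Product using (∃-syntax; _×_; _,_; proj₁; proj₂)
open import Data.Product.Properties using (≡-dec)
open import Data.Sum using (_⊎_; inj₁; inj₂; [_,_]′)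
open import Data.Empty using (⊥; ⊥-elim)
open import Data.List using (List; _∷_; filter; length; concatMap; allFin)
open import Data.List.Properties using (filter-++; length-++; filter-some)
open import Data.List.Membership.Propositional using (_∈_)
open import Data.List.Membership.Propositional.Properties using (∈-map⁺; ∈-map⁻; ∈-filter⁻; ∈-concatMap⁻; ∈-allFin)
import Data.List.Membership.DecPropositional as DecMembership
open import Data.List.Relation.Unary.Any as Any using (here; there; satisfied)
open import Relation.Binary.PropositionalEquality using (_≡_; _≢_; refl; sym; trans; cong; subst; ≢-sym)
open import Relation.Nullary using (¬_; Dec; yes; no)
open import Relation.Nullary.Decidable using (True; toWitness; from-yes; _×-dec_; _⊎-dec_; _→-dec_; ¬?)

Edge : (T : BlockType) → Fin (size T) → Fin (size T) → Set
Edge T u v = (u , v) ∈ edges T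

edge? : ∀ T u v → Dec (Edge T u v)
edge? T u v = (u , v) ∈? edges T
  where open DecMembership (≡-dec _≟_ _≟_)

_≟ᶜ_ : (c c' : Color) → Dec (c ≡ c')
white ≟ᶜ white = yes refl
white ≟ᶜ black = no λ ()
black ≟ᶜ white = no λ ()
black ≟ᶜ black = yes refl

spike? : ∀ T → Dec (T ≡ spike)
spike? spike    = yes refl
spike? triangle = no λ ()
spike? fork-out = no λ ()
spike? fork-in  = no λ ()
spike? diamond  = no λ ()
spike? square   = no λ ()

triangle? : ∀ T → Dec (T ≡ triangle)
triangle? spike    = no λ ()
triangle? triangle = yes refl
triangle? fork-out = no λ ()
triangle? fork-in  = no λ ()
triangle? diamond  = no λ ()
triangle? square   = no λ ()

by-evaluation : {P : BlockType → Set} (P? : ∀ T → Dec (P T)) →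
  {True (P? spike)} → {True (P? triangle)} → {True (P? fork-out)} →
  {True (P? fork-in)} → {True (P? diamond)} → {True (P? square)} → ∀ T → P T
by-evaluation _ {s} {_} {_}  {_}  {_} {_} spike    = toWitness s
by-evaluation _ {_} {t} {_}  {_}  {_} {_} triangle = toWitness t
by-evaluation _ {_} {_} {fo} {_}  {_} {_} fork-out = toWitness fo
by-evaluation _ {_} {_} {_}  {fi} {_} {_} fork-in  = toWitness fi
by-evaluation _ {_} {_} {_}  {_}  {d} {_} diamond  = toWitness d
by-evaluation _ {_} {_} {_}  {_}  {_} {q} square   = toWitness q

no-opposite-edges : ∀ T u v → Edge T u v → ¬ Edge T v u
no-opposite-edges = by-evaluation λ T →
  all? λ u → all? λ v → edge? T u v →-dec ¬? (edge? T v u)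

twin-in-neighbours : ∀ T u v v' → Edge T v u → Edge T v' u → v ≢ v' →
  color T v ≡ black × (∀ s → Edge T s v → Edge T s v')
twin-in-neighbours = by-evaluation λ T →
  all? λ u → all? λ v → all? λ v' → edge? T v u →-dec (edge? T v' u →-dec (¬? (v ≟ v') →-dec
    ((color T v ≟ᶜ black) ×-dec all? λ s → edge? T s v →-dec edge? T s v')))

white-two-path⇒triangle : ∀ T a b c → Edge T a b → Edge T b c →
  color T a ≡ white → color T b ≡ white → color T c ≡ white → T ≡ triangle
white-two-path⇒triangle = by-evaluation λ T →
  all? λ a → all? λ b → all? λ c → edge? T a b →-dec (edge? T b c →-dec
    ((color T a ≟ᶜ white) →-dec ((color T b ≟ᶜ white) →-dec ((color T c ≟ᶜ white) →-dec triangle? T))))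

Branching : (T : BlockType) → Fin (size T) → Fin (size T) → Set
Branching T u v = (∃[ v' ] v' ≢ v × Edge T v' u)
  ⊎ (∃[ w ] ∃[ w' ] w ≢ w' × Edge T u w × Edge T u w' × color T w ≡ black × color T w' ≡ black)

branching? : ∀ T u v → Dec (Branching T u v)
branching? T u v = any? (λ v' → ¬? (v' ≟ v) ×-dec edge? T v' u)
  ⊎-dec any? λ w → any? λ w' → ¬? (w ≟ w') ×-dec edge? T u w ×-dec edge? T u w'
                    ×-dec (color T w ≟ᶜ black) ×-dec (color T w' ≟ᶜ black)

white-target-cases : ∀ T u v → Edge T v u → color T u ≡ white →
  T ≡ spike ⊎ T ≡ triangle ⊎ Branching T u v
white-target-cases = by-evaluation λ T →
  all? λ u → all? λ v → edge? T v u →-dec ((color T u ≟ᶜ white) →-dec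
    (spike? T ⊎-dec triangle? T ⊎-dec branching? T u v))

NoTwoPaths : BlockType → Set
NoTwoPaths T = ∀ {a b c} → Edge T a b → ¬ Edge T b c

spike⇒no-two-paths : ∀ {T} → T ≡ spike → NoTwoPaths T
spike⇒no-two-paths refl {a} {b} {c} = from-yes
  (all? λ a → all? λ b → all? λ c → edge? spike a b →-dec ¬? (edge? spike b c)) a b c

record Triangular (T : BlockType) : Set where
  field
    out-unique : ∀ {u w w'} → Edge T u w → Edge T u w' → w ≡ w'
    in-unique  : ∀ {u v v'} → Edge T v u → Edge T v' u → v ≡ v'
    successor  : ∀ u → ∃[ w ] Edge T u w
    closing    : ∀ {u v w} → Edge T u v → Edge T v w → Edge T w u

triangle⇒triangular : ∀ {T} → T ≡ triangle → Triangular T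
triangle⇒triangular refl = record
  { out-unique = λ {u} {w} {w'} → from-yes
      (all? λ u → all? λ w → all? λ w' → edge? triangle u w →-dec (edge? triangle u w' →-dec (w ≟ w'))) u w w'
  ; in-unique = λ {u} {v} {v'} → from-yes
      (all? λ u → all? λ v → all? λ v' → edge? triangle v u →-dec (edge? triangle v' u →-dec (v ≟ v'))) u v v'
  ; successor = from-yes (all? λ u → any? λ w → edge? triangle u w)
  ; closing = λ {u} {v} {w} → from-yes
      (all? λ u → all? λ v → all? λ w → edge? triangle u v →-dec (edge? triangle v w →-dec edge? triangle w u)) u v w
  }

positive-of-balance : ∀ {a b c d} → a + b ≡ c + d → d < a → 0 < c
positive-of-balance {c = suc _} _ _ = s≤s z≤n
positive-of-balance {a} {b} {zero} a+b≡d d<a = ⊥-elim (<-irrefl refl (<-≤-trans d<a (subst (a ≤_) a+b≡d (m≤m+n a b))))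

nonempty⇒member : ∀ {A : Set} {xs : List A} → 0 < length xs → ∃[ x ] x ∈ xs
nonempty⇒member {xs = x ∷ _} _ = x , here refl

module Decomposition {n : ℕ} {G : Multigraph n} (D : BlockDecomposition G) where
  open BlockDecomposition D

  record Lift (i j : Fin n) : Set where
    constructor lift
    field
      block   : Fin k
      src tgt : Fin (size (type block))
      edge    : Edge (type block) src tgt
      φ-src   : φ (block , src) ≡ i
      φ-tgt   : φ (block , tgt) ≡ j

  open Lift using (block)

  cong-φ : ∀ {b u v} → u ≡ v → φ (b , u) ≡ φ (b , v)
  cong-φ refl = refl

  edge∈blockEdges : ∀ {b u v i j} → Edge (type b) u v → φ (b , u) ≡ i → φ (b , v) ≡ j → (i , j) ∈ blockEdges b
  edge∈blockEdges e refl refl = ∈-map⁺ _ e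

  over? : (i j : Fin n) (e : Fin n × Fin n) → Dec (proj₁ e ≡ i × proj₂ e ≡ j)
  over? i j e = (proj₁ e ≟ i) ×-dec (proj₂ e ≟ j)

  blockCount : Fin n → Fin n → Fin k → ℕ
  blockCount i j b = length (filter (over? i j) (blockEdges b))

  countIn : Fin n → Fin n → List (Fin k) → ℕ
  countIn i j bs = length (filter (over? i j) (concatMap blockEdges bs))

  countIn-∷ : ∀ i j b bs → countIn i j (b ∷ bs) ≡ blockCount i j b + countIn i j bs
  countIn-∷ i j b bs = trans (cong length (filter-++ (over? i j) (blockEdges b) (concatMap blockEdges bs)))
                             (length-++ (filter (over? i j) (blockEdges b)))

  blockCount≤countIn : ∀ i j {b bs} → b ∈ bs → blockCount i j b ≤ countIn i j bs
  blockCount≤countIn i j {bs = c ∷ bs} (here refl) rewrite countIn-∷ i j c bs = m≤m+n _ _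
  blockCount≤countIn i j {bs = c ∷ bs} (there b∈bs) rewrite countIn-∷ i j c bs =
    m≤n⇒m≤o+n (blockCount i j c) (blockCount≤countIn i j b∈bs)

  blockCounts≤countIn : ∀ i j {b b' bs} → b ∈ bs → b' ∈ bs → b ≢ b' →
    blockCount i j b + blockCount i j b' ≤ countIn i j bs
  blockCounts≤countIn i j (here refl) (here refl) b≢b' = ⊥-elim (b≢b' refl)
  blockCounts≤countIn i j {bs = c ∷ bs} (here refl) (there b'∈bs) _ rewrite countIn-∷ i j c bs =
    +-monoʳ-≤ (blockCount i j c) (blockCount≤countIn i j b'∈bs)
  blockCounts≤countIn i j {b} {bs = c ∷ bs} (there b∈bs) (here refl) _ rewrite countIn-∷ i j c bs =
    subst (_≤ blockCount i j c + countIn i j bs) (+-comm (blockCount i j c) (blockCount i j b))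
      (+-monoʳ-≤ (blockCount i j c) (blockCount≤countIn i j b∈bs))
  blockCounts≤countIn i j {bs = c ∷ bs} (there b∈bs) (there b'∈bs) b≢b' rewrite countIn-∷ i j c bs =
    m≤n⇒m≤o+n (blockCount i j c) (blockCounts≤countIn i j b∈bs b'∈bs b≢b')

  lift⇒blockCount : ∀ {i j} (ℓ : Lift i j) → 0 < blockCount i j (block ℓ)
  lift⇒blockCount (lift b u v e refl refl) =
    filter-some (over? _ _) (Any.map (λ { refl → refl , refl }) (∈-map⁺ _ e))

  lift⇒count : ∀ {i j} → Lift i j → 0 < count i j
  lift⇒count ℓ = ≤-trans (lift⇒blockCount ℓ) (blockCount≤countIn _ _ (∈-allFin _))

  lifts⇒count : ∀ {i j} (ℓ ℓ' : Lift i j) → block ℓ ≢ block ℓ' → 2 ≤ count i j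
  lifts⇒count ℓ ℓ' b≢b' = ≤-trans (+-mono-≤ (lift⇒blockCount ℓ) (lift⇒blockCount ℓ'))
                                   (blockCounts≤countIn _ _ (∈-allFin _) (∈-allFin _) b≢b')

  -- Opaque: only the existence of the lift matters, and unfolding it makes every
  -- with-abstraction over a derived lift expensive.
  opaque
    count⇒lift : ∀ {i j} → 0 < count i j → Lift i j
    count⇒lift {i} {j} pos with nonempty⇒member pos
    ... | e , e∈ with ∈-filter⁻ (over? i j) {xs = allEdges} e∈
    ... | e∈all , φu≡i , φv≡j with satisfied (∈-concatMap⁻ blockEdges {xs = allFin k} e∈all)
    ... | b , e∈b with ∈-map⁻ _ e∈b
    ... | (u , v) , uv , refl = lift b u v uv φu≡i φv≡j

  edge⇒lift : ∀ {i j} → 0 < G i j → G j i ≡ 0 → Lift i j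
  edge⇒lift {i} {j} Gij>0 Gji≡0 = count⇒lift (positive-of-balance
    (trans (+-comm (G i j) (count j i)) (edgesMatch j i)) (subst (_< G i j) (sym Gji≡0) Gij>0))

  excess⇒reverse-lift : ∀ {i j} → G i j < count i j → Lift j i
  excess⇒reverse-lift {i} {j} excess = count⇒lift (positive-of-balance (edgesMatch i j) excess)

  reverse-lift : ∀ {i j} → G i j ≡ 0 → Lift i j → Lift j i
  reverse-lift {i} {j} Gij≡0 ℓ = excess⇒reverse-lift (subst (_< count i j) (sym Gij≡0) (lift⇒count ℓ))

  reverse-of-two-lifts : ∀ {i j} → G i j ≤ 1 → (ℓ ℓ' : Lift i j) → block ℓ ≢ block ℓ' → Lift j i
  reverse-of-two-lifts Gij≤1 ℓ ℓ' b≢b' = excess⇒reverse-lift (≤-trans (s≤s Gij≤1) (lifts⇒count ℓ ℓ' b≢b'))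

  φ-injective-on-block : ∀ {b u v} → φ (b , u) ≡ φ (b , v) → u ≡ v
  φ-injective-on-block {b} {u} {v} φu≡φv with glue (b , u) (b , v) φu≡φv
  ... | inj₁ refl = refl
  ... | inj₂ (b≢b , _) = ⊥-elim (b≢b refl)

  distinct-preimages : ∀ {a a'} → φ a ≡ φ a' → a ≢ a' →
    proj₁ a ≢ proj₁ a' × nodeColor a ≡ white × nodeColor a' ≡ white
  distinct-preimages {a} {a'} φa≡φa' a≢a' with glue a a' φa≡φa'
  ... | inj₁ a≡a' = ⊥-elim (a≢a' a≡a')
  ... | inj₂ glued = glued

  black-unique-preimage : ∀ {a a'} → nodeColor a ≡ black → φ a' ≡ φ a → a' ≡ a
  black-unique-preimage {a} {a'} a-black φa'≡φa with glue a' a φa'≡φa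
  ... | inj₁ a'≡a = a'≡a
  ... | inj₂ (_ , _ , a-white) with trans (sym a-black) a-white
  ... | ()

  at-most-two-preimages : ∀ {a a'} → φ a ≡ φ a' → a ≢ a' → ∀ {a''} → φ a'' ≡ φ a → a'' ≡ a ⊎ a'' ≡ a'
  at-most-two-preimages {a} {a'} φa≡φa' a≢a' {a''} φa''≡φa with atMostTwo a a' a'' φa≡φa' (sym φa''≡φa)
  ... | inj₁ a≡a' = ⊥-elim (a≢a' a≡a')
  ... | inj₂ (inj₁ a≡a'') = inj₁ (sym a≡a'')
  ... | inj₂ (inj₂ a'≡a'') = inj₂ (sym a'≡a'')

  two-path-ends-distinct : ∀ {b u v w} → Edge (type b) u v → Edge (type b) v w → φ (b , u) ≢ φ (b , w)
  two-path-ends-distinct {b} {u} {v} e f φu≡φw =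
    no-opposite-edges (type b) v _ f (subst (λ z → Edge (type b) z v) (φ-injective-on-block φu≡φw) e)

  black-edge-not-cancelled : ∀ {b u v i j} → Edge (type b) u v →
    color (type b) u ≡ black ⊎ color (type b) v ≡ black → φ (b , u) ≡ i → φ (b , v) ≡ j → ¬ Lift j i
  black-edge-not-cancelled {b} {u} {v} e (inj₁ u-black) φu φv (lift _ s t e' φs φt)
    with black-unique-preimage {b , u} u-black (trans φt (sym φu))
  ... | refl = no-opposite-edges (type b) u v e
                 (subst (λ z → Edge (type b) z u) (φ-injective-on-block (trans φs (sym φv))) e')
  black-edge-not-cancelled {b} {u} {v} e (inj₂ v-black) φu φv (lift _ s t e' φs φt)
    with black-unique-preimage {b , v} v-black (trans φs (sym φv))
  ... | refl = no-opposite-edges (type b) u v e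
                 (subst (Edge (type b) v) (φ-injective-on-block (trans φt (sym φu))) e')

  out-of-glued-triangles : ∀ {i j k₁ k₂} (ℓ₁ : Lift i k₁) (ℓ₂ : Lift i k₂) → block ℓ₁ ≢ block ℓ₂ →
    Triangular (type (block ℓ₁)) → Triangular (type (block ℓ₂)) → Lift i j → j ≡ k₁ ⊎ j ≡ k₂
  out-of-glued-triangles (lift b₁ a₁ c₁ f₁ φa₁ φc₁) (lift b₂ a₂ c₂ f₂ φa₂ φc₂) b₁≢b₂ T₁ T₂ (lift _ s t g φs φt)
    with at-most-two-preimages (trans φa₁ (sym φa₂)) (b₁≢b₂ ∘ cong proj₁) (trans φs (sym φa₁))
  ... | inj₁ refl = inj₁ (trans (sym φt) (trans (cong-φ (Triangular.out-unique T₁ g f₁)) φc₁))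
  ... | inj₂ refl = inj₂ (trans (sym φt) (trans (cong-φ (Triangular.out-unique T₂ g f₂)) φc₂))

  into-glued-triangles : ∀ {i j k₁ k₂} (ℓ₁ : Lift k₁ i) (ℓ₂ : Lift k₂ i) → block ℓ₁ ≢ block ℓ₂ →
    Triangular (type (block ℓ₁)) → Triangular (type (block ℓ₂)) → Lift j i → j ≡ k₁ ⊎ j ≡ k₂
  into-glued-triangles (lift b₁ c₁ a₁ f₁ φc₁ φa₁) (lift b₂ c₂ a₂ f₂ φc₂ φa₂) b₁≢b₂ T₁ T₂ (lift _ s t g φs φt)
    with at-most-two-preimages (trans φa₁ (sym φa₂)) (b₁≢b₂ ∘ cong proj₁) (trans φt (sym φa₁))
  ... | inj₁ refl = inj₁ (trans (sym φs) (trans (cong-φ (Triangular.in-unique T₁ g f₁)) φc₁))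
  ... | inj₂ refl = inj₂ (trans (sym φs) (trans (cong-φ (Triangular.in-unique T₂ g f₂)) φc₂))

reverse-absent : ∀ {n} {G : Multigraph n} → NoTwoCycles G → ∀ {i j} → 0 < G i j → G j i ≡ 0
reverse-absent noTwoCycles {i} {j} Gij>0 with noTwoCycles i j
... | inj₂ Gji≡0 = Gji≡0
... | inj₁ Gij≡0 with subst (0 <_) Gij≡0 Gij>0
... | ()

≡1⇒positive : ∀ {m} → m ≡ 1 → 0 < m
≡1⇒positive refl = s≤s z≤n

module Configuration {n : ℕ} {G : Multigraph n} (D : BlockDecomposition G) (noTwoCycles : NoTwoCycles G)
  (o x y p : Fin n) (o≢x : o ≢ x) (o≢y : o ≢ y) (o≢p : o ≢ p) (x≢y : x ≢ y) (x≢p : x ≢ p) (y≢p : y ≢ p)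
  (Gox≡1 : G o x ≡ 1) (Gyo≡1 : G y o ≡ 1) (Gpo≡1 : G p o ≡ 1)
  (out-of-o : ∀ i → i ≢ x → G o i ≡ 0) (into-o : ∀ i → i ≢ y → i ≢ p → G i o ≡ 0)
  (Gxy>0 : 0 < G x y) (Gxp≡0 : G x p ≡ 0) (Gyp≡0 : G y p ≡ 0) where

  open BlockDecomposition D
  open Decomposition D
  open Triangular

  Conclusion : Set
  Conclusion = (∃[ b ] (type b ≡ triangle × (o , x) ∈ blockEdges b × (x , y) ∈ blockEdges b × (y , o) ∈ blockEdges b))
             × (∃[ b ] (type b ≡ spike × (p , o) ∈ blockEdges b))

  lift-ox : Lift o x
  lift-ox = edge⇒lift (≡1⇒positive Gox≡1) (reverse-absent noTwoCycles (≡1⇒positive Gox≡1))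

  lift-yo : Lift y o
  lift-yo = edge⇒lift (≡1⇒positive Gyo≡1) (out-of-o y (≢-sym x≢y))

  lift-po : Lift p o
  lift-po = edge⇒lift (≡1⇒positive Gpo≡1) (out-of-o p (≢-sym x≢p))

  lift-xy : Lift x y
  lift-xy = edge⇒lift Gxy>0 (reverse-absent noTwoCycles Gxy>0)

  black-successor : ∀ {b u w} → φ (b , u) ≡ o → Edge (type b) u w → color (type b) w ≡ black → φ (b , w) ≡ x
  black-successor {b} {u} {w} φu f w-black with φ (b , w) ≟ x
  ... | yes φw≡x = φw≡x
  ... | no φw≢x = ⊥-elim (black-edge-not-cancelled f (inj₂ w-black) φu refl
                            (reverse-lift (out-of-o _ φw≢x) (lift b u w f φu refl)))

  black-predecessor : ∀ {b u v} → φ (b , u) ≡ o → Edge (type b) v u → color (type b) v ≡ black →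
    φ (b , v) ≡ y ⊎ φ (b , v) ≡ p
  black-predecessor {b} {u} {v} φu e v-black with φ (b , v) ≟ y | φ (b , v) ≟ p
  ... | yes φv≡y | _ = inj₁ φv≡y
  ... | no _ | yes φv≡p = inj₂ φv≡p
  ... | no φv≢y | no φv≢p = ⊥-elim (black-edge-not-cancelled e (inj₁ v-black) refl φu
                                      (reverse-lift (into-o _ φv≢y φv≢p) (lift b v u e refl φu)))

  -- The lift of x → y enters β, hence also γ, giving an edge x → p that nothing cancels.
  black-y-p-not-nested : ∀ {b β γ} → color (type b) β ≡ black → color (type b) γ ≡ black →
    φ (b , β) ≡ y → φ (b , γ) ≡ p → (∀ s → Edge (type b) s β → Edge (type b) s γ) → ⊥
  black-y-p-not-nested {b} {β} {γ} β-black γ-black φβ φγ into-β⇒into-γ with lift-xy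
  ... | lift _ s t e φs φt with black-unique-preimage {b , β} β-black (trans φt (sym φβ))
  ... | refl = black-edge-not-cancelled (into-β⇒into-γ s e) (inj₂ γ-black) φs φγ
                 (reverse-lift Gxp≡0 (lift b s γ (into-β⇒into-γ s e) φs φγ))

  single-in-neighbour : ∀ {b u v v'} → φ (b , u) ≡ o → Edge (type b) v u → Edge (type b) v' u → v ≡ v'
  single-in-neighbour {b} {u} {v} {v'} φu e e' with v ≟ v'
  ... | yes v≡v' = v≡v'
  ... | no v≢v' with twin-in-neighbours (type b) u v v' e e' v≢v' | twin-in-neighbours (type b) u v' v e' e (≢-sym v≢v')
  ... | v-black , into-v⇒into-v' | v'-black , into-v'⇒into-v
      with black-predecessor φu e v-black | black-predecessor φu e' v'-black
  ... | inj₁ φv≡y | inj₁ φv'≡y = φ-injective-on-block (trans φv≡y (sym φv'≡y))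
  ... | inj₂ φv≡p | inj₂ φv'≡p = φ-injective-on-block (trans φv≡p (sym φv'≡p))
  ... | inj₁ φv≡y | inj₂ φv'≡p = ⊥-elim (black-y-p-not-nested v-black v'-black φv≡y φv'≡p into-v⇒into-v')
  ... | inj₂ φv≡p | inj₁ φv'≡y = ⊥-elim (black-y-p-not-nested v'-black v-black φv'≡y φv≡p into-v'⇒into-v)

  o-block-shape : ∀ {b u v} → φ (b , u) ≡ o → Edge (type b) v u → color (type b) u ≡ white →
    type b ≡ spike ⊎ type b ≡ triangle
  o-block-shape {b} {u} {v} φu e u-white with white-target-cases (type b) u v e u-white
  ... | inj₁ is-spike = inj₁ is-spike
  ... | inj₂ (inj₁ is-triangle) = inj₂ is-triangle
  ... | inj₂ (inj₂ (inj₁ (v' , v'≢v , e'))) = ⊥-elim (v'≢v (single-in-neighbour φu e' e))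
  ... | inj₂ (inj₂ (inj₂ (w , w' , w≢w' , f , f' , w-black , w'-black))) =
        ⊥-elim (w≢w' (φ-injective-on-block (trans (black-successor φu f w-black) (sym (black-successor φu f' w'-black)))))

  y-p-enter-distinct-preimages : ∀ {b u v b' u' v'} → Edge (type b) v u → Edge (type b') v' u' →
    φ (b , u) ≡ o → φ (b , v) ≡ y → φ (b' , v') ≡ p → (b , u) ≢ (b' , u')
  y-p-enter-distinct-preimages {b} e e' φu φv φv' refl =
    y≢p (trans (sym φv) (trans (cong-φ (single-in-neighbour φu e e')) φv'))

  module TwoPreimages
    {b₁ : Fin k} {v₁ u₁ : Fin (size (type b₁))} (e₁ : Edge (type b₁) v₁ u₁) (φv₁ : φ (b₁ , v₁) ≡ y) (φu₁ : φ (b₁ , u₁) ≡ o)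
    {b₂ : Fin k} {v₂ u₂ : Fin (size (type b₂))} (e₂ : Edge (type b₂) v₂ u₂) (φv₂ : φ (b₂ , v₂) ≡ p) (φu₂ : φ (b₂ , u₂) ≡ o)
    where

    u₁≢u₂ : (b₁ , u₁) ≢ (b₂ , u₂)
    u₁≢u₂ = y-p-enter-distinct-preimages e₁ e₂ φu₁ φv₁ φv₂

    glued : b₁ ≢ b₂ × color (type b₁) u₁ ≡ white × color (type b₂) u₂ ≡ white
    glued = distinct-preimages (trans φu₁ (sym φu₂)) u₁≢u₂

    b₁≢b₂ : b₁ ≢ b₂
    b₁≢b₂ = proj₁ glued

    preimage-of-o : ∀ {a} → φ a ≡ o → a ≡ (b₁ , u₁) ⊎ a ≡ (b₂ , u₂)
    preimage-of-o φa = at-most-two-preimages (trans φu₁ (sym φu₂)) u₁≢u₂ (trans φa (sym φu₁))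

    into-o-from-y-or-p : ∀ {i} → Lift i o → i ≡ y ⊎ i ≡ p
    into-o-from-y-or-p (lift b s t e φs φt) with preimage-of-o φt
    ... | inj₁ refl = inj₁ (trans (sym φs) (trans (cong-φ (single-in-neighbour φu₁ e e₁)) φv₁))
    ... | inj₂ refl = inj₂ (trans (sym φs) (trans (cong-φ (single-in-neighbour φu₂ e e₂)) φv₂))

    o-successor : ∀ {b u w} → φ (b , u) ≡ o → Edge (type b) u w → φ (b , w) ≡ x ⊎ φ (b , w) ≡ y ⊎ φ (b , w) ≡ p
    o-successor {b} {u} {w} φu f with φ (b , w) ≟ x
    ... | yes φw≡x = inj₁ φw≡x
    ... | no φw≢x = inj₂ (into-o-from-y-or-p (reverse-lift (out-of-o _ φw≢x) (lift b u w f φu refl)))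

    XSuccessor : (b : Fin k) → Fin (size (type b)) → Set
    XSuccessor b u = ∃[ w ] Edge (type b) u w × φ (b , w) ≡ x

    lift-ox-source : XSuccessor b₁ u₁ ⊎ XSuccessor b₂ u₂
    lift-ox-source with lift-ox
    ... | lift b s t f φs φt with preimage-of-o φs
    ... | inj₁ refl = inj₁ (t , f , φt)
    ... | inj₂ refl = inj₂ (t , f , φt)

    x-successors-in-both : XSuccessor b₁ u₁ → XSuccessor b₂ u₂ → ⊥
    x-successors-in-both (w₁ , f₁ , φw₁) (w₂ , f₂ , φw₂) =
      [ x≢y , x≢p ]′ (into-o-from-y-or-p
        (reverse-of-two-lifts (≤-reflexive Gox≡1) (lift b₁ u₁ w₁ f₁ φu₁ φw₁) (lift b₂ u₂ w₂ f₂ φu₂ φw₂) b₁≢b₂))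

    triangle-and-spike : type b₁ ≡ triangle → type b₂ ≡ spike → Conclusion
    triangle-and-spike t₁ s₂ with lift-ox-source
    ... | inj₂ (_ , f₂ , _) = ⊥-elim (spike⇒no-two-paths s₂ e₂ f₂)
    ... | inj₁ (w₁ , f₁ , φw₁) =
          (b₁ , t₁ , edge∈blockEdges f₁ φu₁ φw₁ , edge∈blockEdges (closing T₁ e₁ f₁) φw₁ φv₁ , edge∈blockEdges e₁ φv₁ φu₁)
        , (b₂ , s₂ , edge∈blockEdges e₂ φv₂ φu₂)
      where
        T₁ : Triangular (type b₁)
        T₁ = triangle⇒triangular t₁

    x-successor-of-triangle : Triangular (type b₁) → ∀ {w} → Edge (type b₁) u₁ w → XSuccessor b₁ u₁ → φ (b₁ , w) ≡ x
    x-successor-of-triangle T {w} f (w' , f' , φw') = trans (cong-φ (out-unique T f f')) φw'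

    -- Triangles over (o, x, y) and (o, y, p), resp. over (o, p, y) and (o, x, p): the edge
    -- y → p, resp. x → p, of the second one has no cancelling lift.
    triangles-oxy-oyp : Triangular (type b₁) → Triangular (type b₂) → ∀ {w₁ w₂} →
      Edge (type b₁) u₁ w₁ → φ (b₁ , w₁) ≡ x → Edge (type b₂) u₂ w₂ → φ (b₂ , w₂) ≡ y → ⊥
    triangles-oxy-oyp T₁ T₂ {w₁} {w₂} f₁ φw₁ f₂ φw₂ =
      [ x≢p ∘ sym , o≢p ∘ sym ]′ (into-glued-triangles
        (lift b₁ w₁ v₁ (closing T₁ e₁ f₁) φw₁ φv₁) (lift b₂ u₂ w₂ f₂ φu₂ φw₂) b₁≢b₂ T₁ T₂
        (reverse-lift Gyp≡0 (lift b₂ w₂ v₂ (closing T₂ e₂ f₂) φw₂ φv₂)))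

    triangles-opy-oxp : Triangular (type b₁) → Triangular (type b₂) → ∀ {w₁ w₂} →
      Edge (type b₁) u₁ w₁ → φ (b₁ , w₁) ≡ p → Edge (type b₂) u₂ w₂ → φ (b₂ , w₂) ≡ x → ⊥
    triangles-opy-oxp T₁ T₂ {w₁} {w₂} f₁ φw₁ f₂ φw₂ =
      [ o≢x ∘ sym , x≢y ]′ (out-of-glued-triangles
        (lift b₂ v₂ u₂ e₂ φv₂ φu₂) (lift b₁ w₁ v₁ (closing T₁ e₁ f₁) φw₁ φv₁) (≢-sym b₁≢b₂) T₂ T₁
        (reverse-lift Gxp≡0 (lift b₂ w₂ v₂ (closing T₂ e₂ f₂) φw₂ φv₂)))

    two-triangles : Triangular (type b₁) → Triangular (type b₂) → ⊥
    two-triangles T₁ T₂ with successor T₁ u₁ | successor T₂ u₂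
    ... | w₁ , f₁ | w₂ , f₂ with o-successor φu₁ f₁ | o-successor φu₂ f₂
    ... | inj₂ (inj₁ φw₁≡y) | _ = two-path-ends-distinct e₁ f₁ (trans φv₁ (sym φw₁≡y))
    ... | _ | inj₂ (inj₂ φw₂≡p) = two-path-ends-distinct e₂ f₂ (trans φv₂ (sym φw₂≡p))
    ... | inj₁ φw₁≡x | inj₁ φw₂≡x = x-successors-in-both (w₁ , f₁ , φw₁≡x) (w₂ , f₂ , φw₂≡x)
    ... | inj₁ φw₁≡x | inj₂ (inj₁ φw₂≡y) = triangles-oxy-oyp T₁ T₂ f₁ φw₁≡x f₂ φw₂≡y
    ... | inj₂ (inj₂ φw₁≡p) | inj₁ φw₂≡x = triangles-opy-oxp T₁ T₂ f₁ φw₁≡p f₂ φw₂≡x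
    ... | inj₂ (inj₂ φw₁≡p) | inj₂ (inj₁ φw₂≡y) with lift-ox-source
    ...   | inj₁ x-succ₁ = x≢p (trans (sym (x-successor-of-triangle T₁ f₁ x-succ₁)) φw₁≡p)
    ...   | inj₂ (w , f , φw) = x≢y (trans (sym φw) (trans (cong-φ (out-unique T₂ f f₂)) φw₂≡y))

    -- The spike leaves the lift of o → x to the triangle, so it is o → x → p, whose edge x → p
    -- is cancelled by a lift π → ξ in a third block. Following the lift of x → y out of ξ gives
    -- a white path π → ξ → η, so that block is a triangle and its edge η → π, i.e. y → p, is
    -- uncancelled.
    module SpikeAndTriangle (s₁ : type b₁ ≡ spike) (T₂ : Triangular (type b₂))
      {w₂ : Fin (size (type b₂))} (f₂ : Edge (type b₂) u₂ w₂) (φw₂ : φ (b₂ , w₂) ≡ x) where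

      px-target-not-w₂ : ∀ {b π ξ} → Edge (type b) π ξ → φ (b , π) ≡ p → (b , ξ) ≢ (b₂ , w₂)
      px-target-not-w₂ g φπ refl = o≢p (trans (sym φu₂) (trans (cong-φ (in-unique T₂ f₂ g)) φπ))

      xy-leaves-second-preimage : ∀ {b ξ} → φ (b , ξ) ≡ x → (b , ξ) ≢ (b₂ , w₂) →
        ∃[ η ] Edge (type b) ξ η × φ (b , η) ≡ y
      xy-leaves-second-preimage φξ ξ≢w₂ with lift-xy
      ... | lift _ s t h φs φt with at-most-two-preimages (trans φw₂ (sym φξ)) (≢-sym ξ≢w₂) (trans φs (sym φw₂))
      ... | inj₁ refl = ⊥-elim (y≢p (trans (sym φt)
                          (trans (cong-φ (out-unique T₂ h (closing T₂ e₂ f₂))) φv₂)))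
      ... | inj₂ refl = t , h , φt

      y-after-x-white : ∀ {b ξ η} → Edge (type b) ξ η → φ (b , η) ≡ y → color (type b) η ≡ white
      y-after-x-white {b} {ξ} {η} h φη = proj₁ (proj₂ (distinct-preimages (trans φη (sym φv₁)) η≢v₁))
        where
          η≢v₁ : (b , η) ≢ (b₁ , v₁)
          η≢v₁ refl = spike⇒no-two-paths s₁ h e₁

      px-lift-impossible : Lift p x → ⊥
      px-lift-impossible (lift b π ξ g φπ φξ)
        with distinct-preimages (trans φξ (sym φw₂)) (px-target-not-w₂ g φπ)
           | xy-leaves-second-preimage φξ (px-target-not-w₂ g φπ)
      ... | b≢b₂ , ξ-white , _ | η , h , φη =
            [ o≢y ∘ sym , x≢y ∘ sym ]′ (out-of-glued-triangles
              (lift b₂ v₂ u₂ e₂ φv₂ φu₂) (lift b π ξ g φπ φξ) (≢-sym b≢b₂) T₂ T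
              (reverse-lift Gyp≡0 (lift b η π (closing T g h) φη φπ)))
        where
          π-white : color (type b) π ≡ white
          π-white = proj₁ (proj₂ (distinct-preimages (trans φπ (sym φv₂)) (b≢b₂ ∘ cong proj₁)))
          T : Triangular (type b)
          T = triangle⇒triangular (white-two-path⇒triangle (type b) π ξ η g h π-white ξ-white (y-after-x-white h φη))

    spike-and-triangle : type b₁ ≡ spike → Triangular (type b₂) → ⊥
    spike-and-triangle s₁ T₂ with lift-ox-source
    ... | inj₁ (_ , f₁ , _) = spike⇒no-two-paths s₁ e₁ f₁
    ... | inj₂ (w₂ , f₂ , φw₂) = SpikeAndTriangle.px-lift-impossible s₁ T₂ f₂ φw₂
                                   (reverse-lift Gxp≡0 (lift b₂ w₂ v₂ (closing T₂ e₂ f₂) φw₂ φv₂))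

    two-spikes : type b₁ ≡ spike → type b₂ ≡ spike → ⊥
    two-spikes s₁ s₂ with lift-ox-source
    ... | inj₁ (_ , f₁ , _) = spike⇒no-two-paths s₁ e₁ f₁
    ... | inj₂ (_ , f₂ , _) = spike⇒no-two-paths s₂ e₂ f₂

    conclusion : Conclusion
    conclusion with o-block-shape φu₁ e₁ (proj₁ (proj₂ glued)) | o-block-shape φu₂ e₂ (proj₂ (proj₂ glued))
    ... | inj₂ t₁ | inj₁ s₂ = triangle-and-spike t₁ s₂
    ... | inj₁ s₁ | inj₁ s₂ = ⊥-elim (two-spikes s₁ s₂)
    ... | inj₁ s₁ | inj₂ t₂ = ⊥-elim (spike-and-triangle s₁ (triangle⇒triangular t₂))
    ... | inj₂ t₁ | inj₂ t₂ = ⊥-elim (two-triangles (triangle⇒triangular t₁) (triangle⇒triangular t₂))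

  conclusion : Conclusion
  conclusion with lift-yo | lift-po
  ... | lift _ _ _ e₁ φv₁ φu₁ | lift _ _ _ e₂ φv₂ φu₂ = TwoPreimages.conclusion e₁ φv₁ φu₁ e₂ φv₂ φu₂

mainTheorem2 : {n : ℕ} (G : Multigraph n) → NoLoops G → NoTwoCycles G →
    BlockDecomposable G →
    (o x y p : Fin n) →
    o ≢ x → o ≢ y → o ≢ p → x ≢ y → x ≢ p → y ≢ p →
    G o x ≡ 1 → G y o ≡ 1 → G p o ≡ 1 →
    ((i : Fin n) → i ≢ x → G o i ≡ 0) →
    ((i : Fin n) → i ≢ y → i ≢ p → G i o ≡ 0) →
    1 ≤ G x y →
    G p x ≡ 0 → G x p ≡ 0 → G p y ≡ 0 → G y p ≡ 0 →
    (D : BlockDecomposition G) →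
      (∃[ b ] (BlockDecomposition.type D b ≡ triangle
               × (o , x) ∈ BlockDecomposition.blockEdges D b
               × (x , y) ∈ BlockDecomposition.blockEdges D b
               × (y , o) ∈ BlockDecomposition.blockEdges D b))
      × (∃[ b ] (BlockDecomposition.type D b ≡ spike
               × (p , o) ∈ BlockDecomposition.blockEdges D b))
mainTheorem2 G _ noTwoCycles _ o x y p o≢x o≢y o≢p x≢y x≢p y≢p Gox≡1 Gyo≡1 Gpo≡1 out-of-o into-o Gxy>0 _ Gxp≡0 _ Gyp≡0 D =
  Configuration.conclusion D noTwoCycles o x y p o≢x o≢y o≢p x≢y x≢p y≢p
    Gox≡1 Gyo≡1 Gpo≡1 out-of-o into-o Gxy>0 Gxp≡0 Gyp≡0
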